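{- Let $P$ be a pTNFA, let $B$ be a separator tree for $P$, and let $v$ be a node of $B$. For every set $S$ of states of $P(v)$, $\mathrm{Close}_{P(v)}(S)$ returns exactly the set of states of $P(v)$ that are reachable from $S$ via a path of $\epsilon$-transitions in $P(v)$.
   Context: A TNFA is produced by Thompson's construction from a regular expression with parse tree $T$ (leaves labeled by characters, internal nodes by $\cdot$, $|$, $*$): $N(\alpha)$ has states $\theta_\alpha,\phi_\alpha$ and an $\alpha$-transition between them; $N(ST)$ adds new $\theta_{ST},\phi_{ST}$ and $\epsilon$-transitions $(\theta_{ST},\theta_S),(\phi_S,\theta_T),(\phi_T,\phi_{ST})$; $N(S|T)$ adds new $\theta_{S|T},\phi_{S|T}$ and $\epsilon$-transitions $(\theta_{S|T},\theta_S),(\theta_{S|T},\theta_T),(\phi_S,\phi_{S|T}),(\phi_T,\phi_{S|T})$; $N(S^*)$ adds new $\theta_{S^*},\phi_{S^*}$ and $\epsilon$-transitions $(\theta_{S^*},\theta_S),(\theta_{S^*},\phi_{S^*}),(\phi_S,\phi_{S^*}),(\phi_S,\theta_S)$. For a TNFA $A$ with parse tree $T$, each node $v$ of $T$ associates the start and accepting states of the subautomaton built for the subtree rooted at $v$. For a cluster $C$ (connected subgraph) of $T$, the pTNFA of $C$ is the subgraph of $A$ induced by all states associated with nodes of $C$, with start and accepting states those associated with the root of $C$; a pTNFA has $2t$ states if its cluster has $t$ nodes. Separator tree $B$ of a pTNFA $P$ with cluster $C$: if $P$ has $2$ states ($\theta_P,\phi_P$), $B$ is a single leaf $v$ with $X(v)=\{\theta_P,\phi_P\}$.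 Otherwise, remove an edge of $C$ splitting it into two clusters, each with at most $\frac{2}{3}t+1$ nodes; let $P_O$ be the pTNFA of the part containing the root of $C$ and $P_I$ the pTNFA of the other part (then every transition from $P_O$ to $P_I$ ends in $\theta_{P_I}$ and every transition from $P_I$ to $P_O$ starts in $\phi_{P_I}$). The root $v$ of $B$ stores $X(v)=\{\theta_{P_I},\phi_{P_I}\}$ and its two children are the roots of separator trees for $P_O$ and $P_I$. Each node $v$ of $B$ corresponds to a pTNFA $P(v)$ (the root to $P$, its children to $P_O$ and $P_I$, etc.); $V(P(v))$ denotes its state set. Procedure $\mathrm{Close}_{P(v)}(S)$: (1) compute the set $Z\subseteq X(v)$ of states in $X(v)$ that are $\epsilon$-reachable from $S$ in $P(v)$. (2) If $v$ is a leaf return $S':=Z$; otherwise let $u,w$ be the children of $v$: (a) compute the set $G\subseteq V(P(v))$ of states of $P(v)$ that are $\epsilon$-reachable from $Z$ in $P(v)$; (b) return $S':=\mathrm{Close}_{P(u)}((S\cup G)\cap V(P(u)))\cup \mathrm{Close}_{P(w)}((S\cup G)\cap V(P(w)))$. -}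

module Defs where

open import Data.Bool using (Bool; true; false; _∧_; _∨_; not)
open import Data.List using (List; []; _∷_; _++_; map; length; filterᵇ)
open import Data.Maybe using (Maybe; just; nothing; _>>=_; Is-just)
open import Data.Nat using (ℕ; _*_; _+_; _≤_)
open import Data.Product using (Σ; _×_; _,_; ∃₂)
open import Data.Sum using (_⊎_)
open import Relation.Binary.PropositionalEquality using (_≡_; _≢_)

data RE (A : Set) : Set where
  chr  : A → RE A
  _·_  : RE A → RE A → RE A
  _∣_  : RE A → RE A → RE A
  _⋆   : RE A → RE A

-- Child directions.  A star node has only the child `lft`.
data Dir : Set where
  lft rgt : Dir

_≟ᵈ_ : Dir → Dir → Bool
lft ≟ᵈ lft = true
rgt ≟ᵈ rgt = true
_   ≟ᵈ _   = false

-- A node of T is identified by its path from the root, stored REVERSED: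
-- the head of the list is the last step.  So the parent of (d ∷ p) is p,
-- and the children of p are (lft ∷ p), (rgt ∷ p).
Pos : Set
Pos = List Dir

_≟ₚ_ : Pos → Pos → Bool
[]      ≟ₚ []      = true
(d ∷ p) ≟ₚ (e ∷ q) = (d ≟ᵈ e) ∧ (p ≟ₚ q)
_       ≟ₚ _       = false

-- c ≼ p : c is an ancestor-or-equal of p  (c is a suffix of p)
_≼_ : Pos → Pos → Bool
c ≼ []      = c ≟ₚ []
c ≼ (d ∷ p) = (c ≟ₚ (d ∷ p)) ∨ (c ≼ p)

child : {A : Set} → Dir → RE A → Maybe (RE A)
child d   (chr a) = nothing
child lft (l · r) = just l
child rgt (l · r) = just r
child lft (l ∣ r) = just l
child rgt (l ∣ r) = just r
child lft (s ⋆)   = just s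
child rgt (s ⋆)   = nothing

at : {A : Set} → RE A → Pos → Maybe (RE A)
at T []      = just T
at T (d ∷ p) = at T p >>= child d

nodes : {A : Set} → RE A → List Pos
nodes (chr a) = [] ∷ []
nodes (l · r) = [] ∷ (map (_++ (lft ∷ [])) (nodes l) ++ map (_++ (rgt ∷ [])) (nodes r))
nodes (l ∣ r) = [] ∷ (map (_++ (lft ∷ [])) (nodes l) ++ map (_++ (rgt ∷ [])) (nodes r))
nodes (s ⋆)   = [] ∷ map (_++ (lft ∷ [])) (nodes s)

-- The TNFA A built by Thompson's construction from T.
-- States: each node v of T gives θ_v and φ_v.

data Side : Set where
  θ φ : Side

State : Set
State = Pos × Side

-- Transitions of A; label `nothing` = ε, `just a` = a-transition.
data Trans {A : Set} (T : RE A) : Maybe A → State → State → Set where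
  chr-t   : ∀ {p a}   → at T p ≡ just (chr a) → Trans T (just a) (p , θ) (p , φ)
  cat-1   : ∀ {p l r} → at T p ≡ just (l · r) → Trans T nothing (p , θ) (lft ∷ p , θ)
  cat-2   : ∀ {p l r} → at T p ≡ just (l · r) → Trans T nothing (lft ∷ p , φ) (rgt ∷ p , θ)
  cat-3   : ∀ {p l r} → at T p ≡ just (l · r) → Trans T nothing (rgt ∷ p , φ) (p , φ)
  alt-1   : ∀ {p l r} → at T p ≡ just (l ∣ r) → Trans T nothing (p , θ) (lft ∷ p , θ)
  alt-2   : ∀ {p l r} → at T p ≡ just (l ∣ r) → Trans T nothing (p , θ) (rgt ∷ p , θ)
  alt-3   : ∀ {p l r} → at T p ≡ just (l ∣ r) → Trans T nothing (lft ∷ p , φ) (p , φ)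
  alt-4   : ∀ {p l r} → at T p ≡ just (l ∣ r) → Trans T nothing (rgt ∷ p , φ) (p , φ)
  star-1  : ∀ {p s}   → at T p ≡ just (s ⋆) → Trans T nothing (p , θ) (lft ∷ p , θ)
  star-2  : ∀ {p s}   → at T p ≡ just (s ⋆) → Trans T nothing (p , θ) (p , φ)
  star-3  : ∀ {p s}   → at T p ≡ just (s ⋆) → Trans T nothing (lft ∷ p , φ) (p , φ)
  star-4  : ∀ {p s}   → at T p ≡ just (s ⋆) → Trans T nothing (lft ∷ p , φ) (lft ∷ p , θ)

-- Clusters: connected subgraphs of T, given by a root and a membership test.

record Cluster {A : Set} (T : RE A) : Set where
  field
    root     : Pos
    mem      : Pos → Bool
    root-mem : mem root ≡ true
    valid    : ∀ p → mem p ≡ true → Is-just (at T p)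
    closed   : ∀ p → mem p ≡ true →
               p ≡ root ⊎ Σ Dir λ d → Σ Pos λ q → (p ≡ d ∷ q) × (mem q ≡ true)
open Cluster public

size : {A : Set} {T : RE A} → Cluster T → ℕ
size {T = T} C = length (filterᵇ (mem C) (nodes T))

-- The pTNFA of C: states associated with nodes of C; transitions are those of
-- A between such states (induced subgraph); start/accept: θ/φ of root C.
InP : {A : Set} {T : RE A} → Cluster T → State → Set
InP C (p , s) = mem C p ≡ true

data Reach {A : Set} {T : RE A} (C : Cluster T) (S : State → Set) : State → Set where
  base : ∀ {x} → S x → InP C x → Reach C S x
  step : ∀ {x y} → Reach C S x → Trans T nothing x y → InP C x → InP C y → Reach C S y

-- Separator trees.  `leaf` : P has 2 states (t = 1), X = {θ_P, φ_P}.
-- `node c ...` : remove the edge between c (a non-root node of C) and its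
-- parent; CI = the part below c (root c), CO = the rest (root of C);
-- each part has at most (2/3) t + 1 nodes, i.e. 3·t' ≤ 2·t + 3.
-- X = {θ_c, φ_c} = {θ_{P_I}, φ_{P_I}}.

data SepTree {A : Set} {T : RE A} (C : Cluster T) : Set where
  leaf : size C ≡ 1 → SepTree C
  node : (c : Pos) → mem C c ≡ true → c ≢ root C →
         (CO CI : Cluster T) →
         root CO ≡ root C → (∀ p → mem CO p ≡ (mem C p ∧ not (c ≼ p))) →
         root CI ≡ c      → (∀ p → mem CI p ≡ (mem C p ∧ (c ≼ p))) →
         3 * size CO ≤ 2 * size C + 3 →
         3 * size CI ≤ 2 * size C + 3 →
         SepTree CO → SepTree CI → SepTree C

X : {A : Set} {T : RE A} {C : Cluster T} → SepTree C → State → Set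
X {C = C} (leaf _) (p , s) = p ≡ root C
X (node c _ _ _ _ _ _ _ _ _ _ _ _) (p , s) = p ≡ c

data NodeB {A : Set} {T : RE A} : {C : Cluster T} → SepTree C → Set where
  here : ∀ {C} {B : SepTree C} → NodeB B
  inO  : ∀ {C c m r CO CI e1 e2 e3 e4 b1 b2} {BO : SepTree CO} {BI : SepTree CI} →
         NodeB BO → NodeB (node {C = C} c m r CO CI e1 e2 e3 e4 b1 b2 BO BI)
  inI  : ∀ {C c m r CO CI e1 e2 e3 e4 b1 b2} {BO : SepTree CO} {BI : SepTree CI} →
         NodeB BI → NodeB (node {C = C} c m r CO CI e1 e2 e3 e4 b1 b2 BO BI)

clusterAt : {A : Set} {T : RE A} {C : Cluster T} {B : SepTree C} → NodeB B → Cluster T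
clusterAt {C = C} here = C
clusterAt (inO n) = clusterAt n
clusterAt (inI n) = clusterAt n

treeAt : {A : Set} {T : RE A} {C : Cluster T} {B : SepTree C} → (v : NodeB B) → SepTree (clusterAt v)
treeAt {B = B} here = B
treeAt (inO n) = treeAt n
treeAt (inI n) = treeAt n

-- Procedure Close_{P(v)}(S), with sets of states as predicates.

Close : {A : Set} {T : RE A} {C : Cluster T} → SepTree C → (State → Set) → (State → Set)
Close {C = C} B@(leaf _) S x = X B x × Reach C S x
Close {C = C} B@(node c _ _ CO CI _ _ _ _ _ _ BO BI) S =
  λ x → Close BO (λ y → (S y ⊎ G y) × InP CO y) x
      ⊎ Close BI (λ y → (S y ⊎ G y) × InP CI y) x
  where
    Z : State → Set
    Z y = X B y × Reach C S y
    G : State → Set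
    G = Reach C Z

-- Cutting the separator edge above c splits P into an outer part P_O and an
-- inner part P_I, and an ε-transition can pass from one part to the other only
-- through θ_c or φ_c, the two states of X. So an ε-path from S either never
-- touches X, and then stays in the part it started in, or it does, and then
-- its remainder is an ε-path from Z in P, i.e. its end lies in G. Hence the
-- reachable set of P is the union of the reachable sets of P_O and P_I from
-- (S ∪ G), and induction on the separator tree does the rest; at a leaf the
-- pTNFA has only the states of X.
module Submission where

open import Defs
open import Data.Bool using (true; false; _∧_; not)
open import Data.Bool.Properties using (T-≡)
open import Data.List using (List; []; _∷_; _∷ʳ_; map; length; filterᵇ; _∷ʳ′_; initLast)
open import Data.List.Membership.Propositional using (_∈_)
open import Data.List.Membership.Propositional.Properties using (∈-map⁺; ∈-++⁺ˡ; ∈-++⁺ʳ; ∈-filter⁺)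
open import Data.List.Relation.Unary.Any using (here; there)
open import Data.Maybe using (just; nothing; _>>=_; Is-just)
open import Data.Product using (_×_; _,_; proj₁; proj₂)
open import Data.Sum using (_⊎_; inj₁; inj₂; [_,_]′)
open import Function using (Equivalence)
open import Relation.Binary.PropositionalEquality using (_≡_; refl; sym; trans; cong₂; subst)

private
  variable
    A : Set
    T : RE A

∧≡true⇒ˡ : ∀ {a b} → a ∧ b ≡ true → a ≡ true
∧≡true⇒ˡ {true} _ = refl

∧≡true⇒ʳ : ∀ {a b} → a ∧ b ≡ true → b ≡ true
∧≡true⇒ʳ {true} eq = eq

≟ᵈ⇒≡ : ∀ d e → (d ≟ᵈ e) ≡ true → d ≡ e
≟ᵈ⇒≡ lft lft _ = refl
≟ᵈ⇒≡ rgt rgt _ = refl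

≟ₚ⇒≡ : ∀ p q → (p ≟ₚ q) ≡ true → p ≡ q
≟ₚ⇒≡ []      []      _  = refl
≟ₚ⇒≡ (d ∷ p) (e ∷ q) eq = cong₂ _∷_ (≟ᵈ⇒≡ d e (∧≡true⇒ˡ eq)) (≟ₚ⇒≡ p q (∧≡true⇒ʳ {d ≟ᵈ e} eq))

at-∷ʳ : (T : RE A) (q : Pos) (d : Dir) → at T (q ∷ʳ d) ≡ (child d T >>= λ T′ → at T′ q)
at-∷ʳ T [] d with child d T
... | just _  = refl
... | nothing = refl
at-∷ʳ T (e ∷ q) d rewrite at-∷ʳ T q d with child d T
... | just _  = refl
... | nothing = refl

root∈nodes : (T : RE A) → [] ∈ nodes T
root∈nodes (chr _) = here refl
root∈nodes (_ · _) = here refl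
root∈nodes (_ ∣ _) = here refl
root∈nodes (_ ⋆)   = here refl

∈nodes : (T : RE A) (p : Pos) → Is-just (at T p) → p ∈ nodes T
∈nodes-child : (T : RE A) (q : Pos) (d : Dir) →
               Is-just (child d T >>= λ T′ → at T′ q) → (q ∷ʳ d) ∈ nodes T

∈nodes T p isNode with initLast p
... | []      = root∈nodes T
... | q ∷ʳ′ d = ∈nodes-child T q d (subst Is-just (at-∷ʳ T q d) isNode)

∈nodes-child (l · r) q lft isNode = there (∈-++⁺ˡ (∈-map⁺ (_∷ʳ lft) (∈nodes l q isNode)))
∈nodes-child (l · r) q rgt isNode =
  there (∈-++⁺ʳ (map (_∷ʳ lft) (nodes l)) (∈-map⁺ (_∷ʳ rgt) (∈nodes r q isNode)))
∈nodes-child (l ∣ r) q lft isNode = there (∈-++⁺ˡ (∈-map⁺ (_∷ʳ lft) (∈nodes l q isNode)))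
∈nodes-child (l ∣ r) q rgt isNode =
  there (∈-++⁺ʳ (map (_∷ʳ lft) (nodes l)) (∈-map⁺ (_∷ʳ rgt) (∈nodes r q isNode)))
∈nodes-child (s ⋆)   q lft isNode = there (∈-map⁺ (_∷ʳ lft) (∈nodes s q isNode))

length≡1⇒∈⇒≡ : {B : Set} (xs : List B) {a b : B} → length xs ≡ 1 → a ∈ xs → b ∈ xs → a ≡ b
length≡1⇒∈⇒≡ (_ ∷ []) _ (here refl) (here refl) = refl

mem⇒∈members : (C : Cluster T) {p : Pos} → mem C p ≡ true → p ∈ filterᵇ (mem C) (nodes T)
mem⇒∈members {T = T} C {p} m =
  ∈-filter⁺ _ (∈nodes T p (valid C p m)) (Equivalence.from T-≡ m)

size≡1⇒mem⇒root : (C : Cluster T) → size C ≡ 1 → ∀ {p} → mem C p ≡ true → p ≡ root C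
size≡1⇒mem⇒root {T = T} C sz m =
  length≡1⇒∈⇒≡ (filterᵇ (mem C) (nodes T)) sz (mem⇒∈members C m) (mem⇒∈members C (root-mem C))

Reach-InP : {C : Cluster T} {S : State → Set} {x : State} → Reach C S x → InP C x
Reach-InP (base _ i)     = i
Reach-InP (step _ _ _ i) = i

Reach-mono : {C D : Cluster T} {S R : State → Set} →
             (∀ {p} → mem C p ≡ true → mem D p ≡ true) → (∀ {y} → S y → Reach D R y) →
             ∀ {x} → Reach C S x → Reach D R x
Reach-mono C⊆D S⊆R (base s _)     = S⊆R s
Reach-mono C⊆D S⊆R (step r t i j) = step (Reach-mono C⊆D S⊆R r) t (C⊆D i) (C⊆D j)

data Crossing (c : Pos) (x y : State) : Set where
  same-side : (c ≼ proj₁ x) ≡ (c ≼ proj₁ y) → Crossing c x y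
  from-c    : proj₁ x ≡ c → Crossing c x y
  to-c      : proj₁ y ≡ c → Crossing c x y

≼-∷ : (c p : Pos) (d : Dir) → (c ≼ p) ≡ (c ≼ (d ∷ p)) ⊎ d ∷ p ≡ c
≼-∷ c p d with c ≟ₚ (d ∷ p) in eq
... | true  = inj₂ (sym (≟ₚ⇒≡ c (d ∷ p) eq))
... | false = inj₁ refl

crossing-down : ∀ c p d → Crossing c (p , θ) (d ∷ p , θ)
crossing-down c p d = [ same-side , to-c ]′ (≼-∷ c p d)

crossing-up : ∀ c p d → Crossing c (d ∷ p , φ) (p , φ)
crossing-up c p d = [ (λ e → same-side (sym e)) , from-c ]′ (≼-∷ c p d)

crossing-sibling : ∀ c p → Crossing c (lft ∷ p , φ) (rgt ∷ p , θ)
crossing-sibling c p with ≼-∷ c p lft | ≼-∷ c p rgt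
... | inj₁ eˡ | inj₁ eʳ = same-side (trans (sym eˡ) eʳ)
... | inj₂ e  | _       = from-c e
... | inj₁ _  | inj₂ e  = to-c e

ε-crossing : (c : Pos) {x y : State} → Trans T nothing x y → Crossing c x y
ε-crossing c (cat-1 {p} _)  = crossing-down c p lft
ε-crossing c (cat-2 {p} _)  = crossing-sibling c p
ε-crossing c (cat-3 {p} _)  = crossing-up c p rgt
ε-crossing c (alt-1 {p} _)  = crossing-down c p lft
ε-crossing c (alt-2 {p} _)  = crossing-down c p rgt
ε-crossing c (alt-3 {p} _)  = crossing-up c p lft
ε-crossing c (alt-4 {p} _)  = crossing-up c p rgt
ε-crossing c (star-1 {p} _) = crossing-down c p lft
ε-crossing c (star-2 _)     = same-side refl
ε-crossing c (star-3 {p} _) = crossing-up c p lft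
ε-crossing c (star-4 _)     = same-side refl

module Split {C CO CI : Cluster T} (c : Pos)
  (mem-CO : ∀ p → mem CO p ≡ (mem C p ∧ not (c ≼ p)))
  (mem-CI : ∀ p → mem CI p ≡ (mem C p ∧ (c ≼ p)))
  (S : State → Set) where

  CO⊆C : ∀ {p} → mem CO p ≡ true → mem C p ≡ true
  CO⊆C {p} m = ∧≡true⇒ˡ (trans (sym (mem-CO p)) m)

  CI⊆C : ∀ {p} → mem CI p ≡ true → mem C p ≡ true
  CI⊆C {p} m = ∧≡true⇒ˡ (trans (sym (mem-CI p)) m)

  outside⇒CO : ∀ {p} → mem C p ≡ true → (c ≼ p) ≡ false → mem CO p ≡ true
  outside⇒CO {p} m b rewrite mem-CO p | m | b = refl

  inside⇒CI : ∀ {p} → mem C p ≡ true → (c ≼ p) ≡ true → mem CI p ≡ true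
  inside⇒CI {p} m b rewrite mem-CI p | m | b = refl

  Z : State → Set
  Z y = proj₁ y ≡ c × Reach C S y

  G : State → Set
  G = Reach C Z

  Seeds : Cluster T → State → Set
  Seeds D y = (S y ⊎ G y) × InP D y

  G⊆Reach : ∀ {y} → G y → Reach C S y
  G⊆Reach = Reach-mono (λ m → m) proj₂

  Seeds⊆Reach : {D : Cluster T} → (∀ {p} → mem D p ≡ true → mem C p ≡ true) →
                ∀ {y} → Seeds D y → Reach C S y
  Seeds⊆Reach D⊆C (inj₁ s , i) = base s (D⊆C i)
  Seeds⊆Reach D⊆C (inj₂ g , _) = G⊆Reach g

  data OnSide (y : State) : Set where
    outer : (c ≼ proj₁ y) ≡ false → Reach CO (Seeds CO) y → OnSide y
    inner : (c ≼ proj₁ y) ≡ true  → Reach CI (Seeds CI) y → OnSide y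

  seed-OnSide : ∀ {y} → InP C y → S y ⊎ G y → OnSide y
  seed-OnSide {p , _} i sg with c ≼ p in b
  ... | false = outer b (base (sg , outside⇒CO i b) (outside⇒CO i b))
  ... | true  = inner b (base (sg , inside⇒CI i b) (inside⇒CI i b))

  step-OnSide : ∀ {x y} → OnSide x → Trans T nothing x y →
                (c ≼ proj₁ x) ≡ (c ≼ proj₁ y) → InP C y → OnSide y
  step-OnSide (outer b r) t e i =
    let b′ = trans (sym e) b in outer b′ (step r t (Reach-InP r) (outside⇒CO i b′))
  step-OnSide (inner b r) t e i =
    let b′ = trans (sym e) b in inner b′ (step r t (Reach-InP r) (inside⇒CI i b′))

  Reach-split : ∀ {y} → Reach C S y → G y ⊎ OnSide y
  Reach-split (base s i) = inj₂ (seed-OnSide i (inj₁ s))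
  Reach-split (step r t ix iy) with Reach-split r
  ... | inj₁ g    = inj₁ (step g t ix iy)
  ... | inj₂ side with ε-crossing c t
  ...   | same-side e = inj₂ (step-OnSide side t e iy)
  ...   | from-c e    = inj₁ (step (base (e , r) ix) t ix iy)
  ...   | to-c e      = inj₁ (base (e , step r t ix iy) iy)

Close-sound : {C : Cluster T} (B : SepTree C) (S : State → Set) →
              ∀ {x} → Close B S x → Reach C S x
Close-sound (leaf _) S (_ , r) = r
Close-sound {C = C} (node c _ _ CO CI _ mem-CO _ mem-CI _ _ BO BI) S (inj₁ cl) =
  Reach-mono CO⊆C (Seeds⊆Reach {D = CO} CO⊆C) (Close-sound BO (Seeds CO) cl)
  where open Split {C = C} {CO} {CI} c mem-CO mem-CI S
Close-sound {C = C} (node c _ _ CO CI _ mem-CO _ mem-CI _ _ BO BI) S (inj₂ cl) =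
  Reach-mono CI⊆C (Seeds⊆Reach {D = CI} CI⊆C) (Close-sound BI (Seeds CI) cl)
  where open Split {C = C} {CO} {CI} c mem-CO mem-CI S

Close-complete : {C : Cluster T} (B : SepTree C) (S : State → Set) →
                 ∀ {x} → Reach C S x → Close B S x
Close-complete {C = C} (leaf sz) S r = size≡1⇒mem⇒root C sz (Reach-InP r) , r
Close-complete {C = C} (node c _ _ CO CI _ mem-CO _ mem-CI _ _ BO BI) S r =
  close-OnSide ([ (λ g → seed-OnSide (Reach-InP r) (inj₂ g)) , (λ side → side) ]′ (Reach-split r))
  where
    open Split {C = C} {CO} {CI} c mem-CO mem-CI S
    close-OnSide : ∀ {x} → OnSide x → Close BO (Seeds CO) x ⊎ Close BI (Seeds CI) x
    close-OnSide (outer _ ro) = inj₁ (Close-complete BO (Seeds CO) ro)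
    close-OnSide (inner _ ri) = inj₂ (Close-complete BI (Seeds CI) ri)

lemma8 : {A : Set} (T : RE A) (C : Cluster T) (B : SepTree C) (v : NodeB B)
         (S : State → Set) → (∀ x → S x → InP (clusterAt v) x) →
         ∀ x → (Close (treeAt v) S x → Reach (clusterAt v) S x)
             × (Reach (clusterAt v) S x → Close (treeAt v) S x)
lemma8 _ _ _ v S _ _ = Close-sound (treeAt v) S , Close-complete (treeAt v) S
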